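{- Let $$T(v) = \min\Big\{k \in \mathbb{N} : v \le \max_{2 \le d \le k-1} f_{d-1}(\mathcal{C}(k,d))\Big\}.$$ Then $T(n)$ is asymptotically equivalent to $\log_\phi(n)$, i.e. $\lim_{n\to\infty} \frac{T(n)}{\log_\phi(n)} = 1$, where $\phi=\frac{1+\sqrt5}{2}$ is the golden ratio. Equivalently, $\lim_{n\to\infty}\frac{T(n)}{\log_2(n)} = \log_\phi(2)$.
   Context: $\mathcal{C}(k,d)$ denotes the cyclic $d$-polytope with $k$ vertices (convex hull of $k$ distinct points on the moment curve $\{(\tau,\dots,\tau^d):\tau\in\mathbb{R}\}$), and $f_{d-1}(\mathcal{C}(k,d))$ is its number of facets: $\frac{k}{k-n}\binom{k-n}{n}$ if $d=2n$, and $2\binom{k-n-1}{n}$ if $d=2n+1$. -}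

module Defs where

open import Data.Nat using (ℕ; zero; suc; _+_; _*_; _∸_; _^_; _≤_; _<_; _⊔_)
open import Data.Nat.DivMod using (_/_)
open import Data.Nat.Combinatorics using (_C_)
open import Data.Bool using (Bool; true; false)
open import Data.Product using (_×_; _,_)
open import Data.List using (List; map; foldr; upTo)
open import Relation.Nullary using (¬_)

halfParity : ℕ → ℕ × Bool
halfParity zero = 0 , false
halfParity (suc d) with halfParity d
... | n , false = n , true
... | n , true  = suc n , false

-- number of facets of C(k, 2n):  k/(k-n) * binom(k-n, n)
-- (k ∸ n = 0 never happens in the range 2 ≤ d ≤ k-1; value 0 there is a dummy)
evenFacets : ℕ → ℕ → ℕ
evenFacets k n with k ∸ n
... | zero  = 0
... | suc m = (k * (suc m C n)) / suc m

-- f_{d-1}(C(k,d)) : number of facets of the cyclic d-polytope with k vertices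
-- d = 2n   :  k/(k-n) * binom(k-n, n)
-- d = 2n+1 :  2 * binom(k-n-1, n)
cyclicFacets : ℕ → ℕ → ℕ
cyclicFacets k d with halfParity d
... | n , false = evenFacets k n
... | n , true  = 2 * ((k ∸ n ∸ 1) C n)

-- max_{2 ≤ d ≤ k-1} f_{d-1}(C(k,d))   (empty max := 0, only for k ≤ 2)
maxFacets : ℕ → ℕ
maxFacets k = foldr _⊔_ 0 (map (λ i → cyclicFacets k (i + 2)) (upTo (k ∸ 2)))

-- IsT v k  :  k = T(v) = min { k : v ≤ maxFacets k }
IsT : ℕ → ℕ → Set
IsT v k = (v ≤ maxFacets k) × (∀ j → j < k → ¬ (v ≤ maxFacets j))

-- Golden ratio φ = (1+√5)/2.  φ^m = F(m-1) + F(m) φ  with F(-1)=1, F(0)=0.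
-- phiPow m = (F(m-1) , F(m))
phiPow : ℕ → ℕ × ℕ
phiPow zero = 1 , 0
phiPow (suc m) with phiPow m
... | a , b = b , a + b      -- (a + bφ)φ = b + (a+b)φ

-- exact comparisons between φ^m and a natural number N.
-- a + bφ ≤ N  ⇔  a ≤ N ∧ b√5 ≤ 2(N-a) - b
PhiPow≤ : ℕ → ℕ → Set
PhiPow≤ m N with phiPow m
... | a , b = (a ≤ N) × (b ≤ 2 * (N ∸ a)) × (5 * (b * b) ≤ (2 * (N ∸ a) ∸ b) ^ 2)

-- N ≤ a + bφ  ⇔  2(N-a) - b ≤ b√5   (truncated subtraction handles trivial cases)
≤PhiPow : ℕ → ℕ → Set
≤PhiPow N m with phiPow m
... | a , b = (2 * (N ∸ a) ∸ b) ^ 2 ≤ 5 * (b * b)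

-- The proof compares everything with Fibonacci numbers, using F(m + 1) ≤ φ^m ≤ F(m + 2).
-- Each facet count of C(k, d) is at most 2k times a binomial coefficient i C j with i + j ≤ k,
-- and i C j ≤ F(i + j + 1), so max_d f_{d-1}(C(k, d)) ≤ (2 + k) F(k + 1).  Conversely F(m + 1) is the
-- sum of the m + 1 binomials i C j with i + j = m along a shallow diagonal of Pascal's triangle,
-- and each of them is at most half an odd-dimensional facet count of C(m + 1, 2j + 1), so
-- F(m + 1) ≤ (m + 1)(1 + max_d f_{d-1}(C(m + 1, d))).  Hence for k = T(n) the number n lies between
-- F(k − 1)/(k − 1) and (k + 2) F(k + 1), i.e. log_φ n = k + O(log k); as k^e ≤ F(k) for large k,
-- these polynomial factors are absorbed by any relative error ε = a/b.
module Submission where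

open import Defs
open import Data.Nat using (ℕ; zero; suc; _+_; _*_; _∸_; _^_; _≤_; _<_; _⊔_; z≤n; s≤s; NonZero; >-nonZero; _≤?_)
open import Data.Nat.Properties
open import Data.Nat.Tactic.RingSolver using (solve-∀)
open import Data.Nat.Combinatorics using (_C_; nCk+nC[k+1]≡[n+1]C[k+1]; k>n⇒nCk≡0; nCn≡1; nC1≡n)
open import Data.Nat.DivMod using (_/_; m/n≤m; m*n/n≡m)
open import Data.Bool using (true; false)
open import Data.Product using (_×_; _,_; ∃-syntax; proj₁)
open import Data.Sum using (_⊎_; inj₁; inj₂; [_,_]′)
open import Data.List using (upTo)
open import Data.List.Properties using (foldr-preservesᵇ; foldr-preservesᵒ)
open import Data.List.Relation.Unary.All using (universal)
open import Data.List.Relation.Unary.All.Properties using (map⁺)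
open import Data.List.Relation.Unary.Any.Properties using () renaming (map⁺ to any-map⁺)
open import Data.List.Membership.Propositional using (lose)
open import Data.List.Membership.Propositional.Properties using (∈-upTo⁺)
open import Relation.Nullary using (¬_; yes; no)
open import Relation.Unary using (Decidable)
open import Relation.Binary.PropositionalEquality

^-distribʳ-* : ∀ m n c → (m * n) ^ c ≡ m ^ c * n ^ c
^-distribʳ-* m n zero    = refl
^-distribʳ-* m n (suc c) rewrite ^-distribʳ-* m n c = interchange m n (m ^ c) (n ^ c)
  where
  interchange : ∀ x y p q → x * y * (p * q) ≡ x * p * (y * q)
  interchange = solve-∀

[3+k]^c≤[2+k]^[2*c] : ∀ c k → (3 + k) ^ c ≤ (2 + k) ^ (2 * c)
[3+k]^c≤[2+k]^[2*c] c k = begin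
  (3 + k) ^ c         ≤⟨ ^-monoˡ-≤ c (≤-trans (m≤m+n (3 + k) (k * k + 3 * k + 1)) (≤-reflexive (square k))) ⟩
  ((2 + k) ^ 2) ^ c   ≡⟨ ^-*-assoc (2 + k) 2 c ⟩
  (2 + k) ^ (2 * c)   ∎
  where
  open ≤-Reasoning
  square : ∀ k → (3 + k) + (k * k + 3 * k + 1) ≡ (2 + k) * ((2 + k) * 1)
  square = solve-∀

suc[m∸n]≤m : ∀ {m n} → 1 ≤ m → 1 ≤ n → suc (m ∸ n) ≤ m
suc[m∸n]≤m {suc m} {suc n} _ _ = s≤s (m∸n≤m m n)

-- Fibonacci numbers

fib : ℕ → ℕ
fib 0 = 0
fib 1 = 1
fib (suc (suc n)) = fib (suc n) + fib n

fib[n]≤fib[1+n] : ∀ n → fib n ≤ fib (suc n)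
fib[n]≤fib[1+n] zero    = z≤n
fib[n]≤fib[1+n] (suc n) = m≤m+n (fib (suc n)) (fib n)

fib-mono : ∀ {m n} → m ≤ n → fib m ≤ fib n
fib-mono {m} m≤n with m≤n⇒∃[o]m+o≡n m≤n
... | o , refl = fib[m]≤fib[m+o] o
  where
  fib[m]≤fib[m+o] : ∀ o → fib m ≤ fib (m + o)
  fib[m]≤fib[m+o] zero    rewrite +-identityʳ m = ≤-refl
  fib[m]≤fib[m+o] (suc o) rewrite +-suc m o = ≤-trans (fib[m]≤fib[m+o] o) (fib[n]≤fib[1+n] (m + o))

1≤fib[1+n] : ∀ n → 1 ≤ fib (suc n)
1≤fib[1+n] n = fib-mono {1} {suc n} (s≤s z≤n)

fib[2+n]≤2*fib[1+n] : ∀ n → fib (2 + n) ≤ 2 * fib (1 + n)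
fib[2+n]≤2*fib[1+n] n =
  subst (fib (2 + n) ≤_) (cong (fib (1 + n) +_) (sym (+-identityʳ _)))
        (+-monoʳ-≤ (fib (1 + n)) (fib[n]≤fib[1+n] n))

3*fib[2+n]≤2*fib[3+n] : ∀ n → 3 * fib (2 + n) ≤ 2 * fib (3 + n)
3*fib[2+n]≤2*fib[3+n] n = begin
  3 * fib (2 + n)                   ≡⟨ 3*x≡2*x+x (fib (2 + n)) ⟩
  2 * fib (2 + n) + fib (2 + n)     ≤⟨ +-monoʳ-≤ (2 * fib (2 + n)) (fib[2+n]≤2*fib[1+n] n) ⟩
  2 * fib (2 + n) + 2 * fib (1 + n) ≡⟨ *-distribˡ-+ 2 (fib (2 + n)) (fib (1 + n)) ⟨
  2 * fib (3 + n)                   ∎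
  where
  open ≤-Reasoning
  3*x≡2*x+x : ∀ x → 3 * x ≡ 2 * x + x
  3*x≡2*x+x = solve-∀

fib-+ : ∀ m n → fib (suc (m + n)) ≡ fib (suc m) * fib (suc n) + fib m * fib n
fib-+ zero          n = sym (trans (+-identityʳ _) (+-identityʳ _))
fib-+ (suc zero)    n = unit-coefficients (fib (suc n)) (fib n)
  where
  unit-coefficients : ∀ x y → x + y ≡ (x + 0 * x) + (y + 0)
  unit-coefficients = solve-∀
fib-+ (suc (suc m)) n = begin
  fib (2 + m + n) + fib (1 + m + n)
    ≡⟨ cong₂ _+_ (fib-+ (suc m) n) (fib-+ m n) ⟩
  (fib (2 + m) * fib (1 + n) + fib (1 + m) * fib n) + (fib (1 + m) * fib (1 + n) + fib m * fib n)
    ≡⟨ regroup (fib (2 + m)) (fib (1 + m)) (fib m) (fib (1 + n)) (fib n) ⟩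
  (fib (2 + m) + fib (1 + m)) * fib (1 + n) + (fib (1 + m) + fib m) * fib n
    ∎
  where
  open ≡-Reasoning
  regroup : ∀ a b c x y → (a * x + b * y) + (b * x + c * y) ≡ (a + b) * x + (b + c) * y
  regroup = solve-∀

fib[1+m]*fib[1+n]≤fib[1+m+n] : ∀ m n → fib (suc m) * fib (suc n) ≤ fib (suc (m + n))
fib[1+m]*fib[1+n]≤fib[1+m+n] m n rewrite fib-+ m n = m≤m+n _ _

fib[m+n]≤fib[1+m]*fib[1+n] : ∀ m n → fib (m + n) ≤ fib (suc m) * fib (suc n)
fib[m+n]≤fib[1+m]*fib[1+n] zero    n = subst (fib n ≤_) (sym (+-identityʳ _)) (fib[n]≤fib[1+n] n)
fib[m+n]≤fib[1+m]*fib[1+n] (suc m) n rewrite fib-+ m n = begin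
  fib (suc m) * fib (suc n) + fib m * fib n         ≤⟨ +-monoʳ-≤ _ (*-monoʳ-≤ (fib m) (fib[n]≤fib[1+n] n)) ⟩
  fib (suc m) * fib (suc n) + fib m * fib (suc n)   ≡⟨ *-distribʳ-+ (fib (suc n)) (fib (suc m)) (fib m) ⟨
  fib (2 + m) * fib (suc n)                         ∎
  where open ≤-Reasoning

fib[1+n]^c≤fib[1+c*n] : ∀ c n → fib (suc n) ^ c ≤ fib (suc (c * n))
fib[1+n]^c≤fib[1+c*n] zero    n = ≤-refl
fib[1+n]^c≤fib[1+c*n] (suc c) n =
  ≤-trans (*-monoʳ-≤ (fib (suc n)) (fib[1+n]^c≤fib[1+c*n] c n)) (fib[1+m]*fib[1+n]≤fib[1+m+n] n (c * n))

fib[b*n+j]≤fib[1+n]^b*fib[j+b] : ∀ b n j → fib (b * n + j) ≤ fib (suc n) ^ b * fib (j + b)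
fib[b*n+j]≤fib[1+n]^b*fib[j+b] zero    n j = ≤-reflexive (trans (cong fib (sym (+-identityʳ j))) (sym (+-identityʳ _)))
fib[b*n+j]≤fib[1+n]^b*fib[j+b] (suc b) n j = begin
  fib ((n + b * n) + j)                               ≡⟨ cong fib (+-assoc n (b * n) j) ⟩
  fib (n + (b * n + j))                               ≤⟨ fib[m+n]≤fib[1+m]*fib[1+n] n (b * n + j) ⟩
  fib (suc n) * fib (suc (b * n + j))                 ≡⟨ cong (λ t → fib (suc n) * fib t) (+-suc (b * n) j) ⟨
  fib (suc n) * fib (b * n + suc j)                   ≤⟨ *-monoʳ-≤ (fib (suc n)) (fib[b*n+j]≤fib[1+n]^b*fib[j+b] b n (suc j)) ⟩
  fib (suc n) * (fib (suc n) ^ b * fib (suc j + b))   ≡⟨ *-assoc (fib (suc n)) _ _ ⟨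
  fib (suc n) ^ suc b * fib (suc (j + b))             ≡⟨ cong (λ t → fib (suc n) ^ suc b * fib t) (+-suc j b) ⟨
  fib (suc n) ^ suc b * fib (j + suc b)               ∎
  where open ≤-Reasoning

-- Powers of the golden ratio

fibPred : ℕ → ℕ
fibPred zero    = 1
fibPred (suc m) = fib m

fibPred+fib : ∀ m → fibPred m + fib m ≡ fib (suc m)
fibPred+fib zero    = refl
fibPred+fib (suc m) = +-comm (fib m) (fib (suc m))

fibPred+2*fib : ∀ m → fibPred m + 2 * fib m ≡ fib (2 + m)
fibPred+2*fib m = begin
  fibPred m + (fib m + (fib m + 0)) ≡⟨ cong (λ t → fibPred m + (fib m + t)) (+-identityʳ (fib m)) ⟩
  fibPred m + (fib m + fib m)       ≡⟨ +-assoc (fibPred m) (fib m) (fib m) ⟨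
  (fibPred m + fib m) + fib m       ≡⟨ cong (_+ fib m) (fibPred+fib m) ⟩
  fib (suc m) + fib m               ∎
  where open ≡-Reasoning

phiPow≡ : ∀ m → phiPow m ≡ (fibPred m , fib m)
phiPow≡ zero = refl
phiPow≡ (suc m) rewrite phiPow≡ m = cong (fib m ,_) (fibPred+fib m)

-- The encodings PhiPow≤ and ≤PhiPow of a + bφ ≤ N and N ≤ a + bφ; they hold because 1 ≤ φ ≤ 2.
a+2b≤N⇒a+bφ≤N : ∀ a b N → a + 2 * b ≤ N →
                 a ≤ N × b ≤ 2 * (N ∸ a) × 5 * (b * b) ≤ (2 * (N ∸ a) ∸ b) ^ 2
a+2b≤N⇒a+bφ≤N a b N a+2b≤N with m≤n⇒∃[o]m+o≡n a+2b≤N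
... | o , refl =
  ≤-trans (m≤m+n a (2 * b)) (m≤m+n (a + 2 * b) o) ,
  subst (λ t → b ≤ 2 * t) (sym N∸a≡2b+o)
    (≤-trans (m≤m+n b (b + 2 * o + 2 * b)) (≤-reflexive (b+[b+2o+2b]≡2[2b+o] b o))) ,
  subst (λ t → 5 * (b * b) ≤ t ^ 2) (sym 2[N∸a]∸b≡3b+2o)
    (≤-trans (m≤m+n (5 * (b * b)) _) (≤-reflexive (square-expansion b o)))
  where
  N∸a≡2b+o : a + 2 * b + o ∸ a ≡ 2 * b + o
  N∸a≡2b+o = trans (cong (_∸ a) (+-assoc a (2 * b) o)) (m+n∸m≡n a (2 * b + o))
  2[N∸a]∸b≡3b+2o : 2 * (a + 2 * b + o ∸ a) ∸ b ≡ 3 * b + 2 * o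
  2[N∸a]∸b≡3b+2o = begin
    2 * (a + 2 * b + o ∸ a) ∸ b ≡⟨ cong (λ t → 2 * t ∸ b) N∸a≡2b+o ⟩
    2 * (2 * b + o) ∸ b         ≡⟨ cong (_∸ b) (split b o) ⟩
    b + (3 * b + 2 * o) ∸ b     ≡⟨ m+n∸m≡n b (3 * b + 2 * o) ⟩
    3 * b + 2 * o               ∎
    where
    split : ∀ b o → 2 * (2 * b + o) ≡ b + (3 * b + 2 * o)
    split = solve-∀
    open ≡-Reasoning
  b+[b+2o+2b]≡2[2b+o] : ∀ b o → b + (b + 2 * o + 2 * b) ≡ 2 * (2 * b + o)
  b+[b+2o+2b]≡2[2b+o] = solve-∀
  square-expansion : ∀ b o → 5 * (b * b) + (4 * (b * b) + 12 * (b * o) + 4 * (o * o)) ≡ (3 * b + 2 * o) * ((3 * b + 2 * o) * 1)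
  square-expansion = solve-∀

N≤a+b⇒N≤a+bφ : ∀ a b N → N ≤ a + b → (2 * (N ∸ a) ∸ b) ^ 2 ≤ 5 * (b * b)
N≤a+b⇒N≤a+bφ a b N N≤a+b = begin
  (2 * (N ∸ a) ∸ b) ^ 2   ≤⟨ ^-monoˡ-≤ 2 2[N∸a]∸b≤b ⟩
  b ^ 2                   ≡⟨ cong (b *_) (*-identityʳ b) ⟩
  b * b                   ≤⟨ m≤n*m (b * b) 5 ⟩
  5 * (b * b)             ∎
  where
  open ≤-Reasoning
  N∸a≤b : N ∸ a ≤ b
  N∸a≤b = subst (N ∸ a ≤_) (m+n∸m≡n a b) (∸-monoˡ-≤ a N≤a+b)
  2[N∸a]∸b≤b : 2 * (N ∸ a) ∸ b ≤ b
  2[N∸a]∸b≤b = subst (2 * (N ∸ a) ∸ b ≤_) (m+n∸n≡m b b)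
    (∸-monoˡ-≤ b (subst (2 * (N ∸ a) ≤_) (cong (b +_) (+-identityʳ b)) (*-monoʳ-≤ 2 N∸a≤b)))

fib[2+m]≤N⇒φ^m≤N : ∀ m N → fib (2 + m) ≤ N → PhiPow≤ m N
fib[2+m]≤N⇒φ^m≤N m N fib[2+m]≤N with phiPow m | phiPow≡ m
... | _ | refl = a+2b≤N⇒a+bφ≤N (fibPred m) (fib m) N (subst (_≤ N) (sym (fibPred+2*fib m)) fib[2+m]≤N)

N≤fib[1+m]⇒N≤φ^m : ∀ N m → N ≤ fib (1 + m) → ≤PhiPow N m
N≤fib[1+m]⇒N≤φ^m N m N≤fib[1+m] with phiPow m | phiPow≡ m
... | _ | refl = N≤a+b⇒N≤a+bφ (fibPred m) (fib m) N (subst (N ≤_) (sym (fibPred+fib m)) N≤fib[1+m])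

-- Polynomial versus geometric growth

-- (1 + 1/k)^i ≤ k/(k − i); for 3e ≤ k this gives (1 + 1/k)^e ≤ 3/2, the growth ratio assumed of f below.
[1+k]^i*r≤k^[1+i] : ∀ k i r → i + r ≡ k → suc k ^ i * r ≤ k ^ suc i
[1+k]^i*r≤k^[1+i] k zero    r refl = ≤-reflexive (trans (+-identityʳ r) (sym (*-identityʳ r)))
[1+k]^i*r≤k^[1+i] k (suc i) r i+r≡k = begin
  (suc k * suc k ^ i) * r   ≡⟨ swap₁ (suc k) (suc k ^ i) r ⟩
  suc k ^ i * (suc k * r)   ≤⟨ *-monoʳ-≤ (suc k ^ i) [1+k]r≤k[1+r] ⟩
  suc k ^ i * (k * suc r)   ≡⟨ swap₂ (suc k ^ i) k (suc r) ⟩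
  k * (suc k ^ i * suc r)   ≤⟨ *-monoʳ-≤ k ([1+k]^i*r≤k^[1+i] k i (suc r) (trans (+-suc i r) i+r≡k)) ⟩
  k * k ^ suc i             ∎
  where
  open ≤-Reasoning
  r≤k : r ≤ k
  r≤k = subst (r ≤_) i+r≡k (≤-trans (m≤n+m r i) (n≤1+n (i + r)))
  [1+k]r≤k[1+r] : suc k * r ≤ k * suc r
  [1+k]r≤k[1+r] = begin
    r + k * r   ≡⟨ +-comm r (k * r) ⟩
    k * r + r   ≤⟨ +-monoʳ-≤ (k * r) r≤k ⟩
    k * r + k   ≡⟨ trans (*-suc k r) (+-comm k (k * r)) ⟨
    k * suc r   ∎
  swap₁ : ∀ a b c → (a * b) * c ≡ b * (a * c)
  swap₁ = solve-∀
  swap₂ : ∀ a b c → a * (b * c) ≡ b * (a * c)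
  swap₂ = solve-∀

2*[1+k]^e≤3*k^e : ∀ e k → 3 * e ≤ k → 2 * suc k ^ e ≤ 3 * k ^ e
2*[1+k]^e≤3*k^e zero    zero    _  = s≤s (s≤s z≤n)
2*[1+k]^e≤3*k^e (suc e) zero    ()
2*[1+k]^e≤3*k^e e       k@(suc _) 3e≤k = *-cancelˡ-≤ k (begin
  k * (2 * suc k ^ e)   ≡⟨ swap₁ k (suc k ^ e) ⟩
  (2 * k) * suc k ^ e   ≤⟨ *-monoˡ-≤ (suc k ^ e) 2k≤3r ⟩
  (3 * r) * suc k ^ e   ≡⟨ swap₂ r (suc k ^ e) ⟩
  3 * (suc k ^ e * r)   ≤⟨ *-monoʳ-≤ 3 ([1+k]^i*r≤k^[1+i] k e r e+r≡k) ⟩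
  3 * (k * k ^ e)       ≡⟨ swap₃ k (k ^ e) ⟩
  k * (3 * k ^ e)       ∎)
  where
  open ≤-Reasoning
  r = k ∸ e
  e+r≡k : e + r ≡ k
  e+r≡k = m+[n∸m]≡n (≤-trans (m≤n*m e 3) 3e≤k)
  2a+a≡3a : ∀ a → 2 * a + a ≡ 3 * a
  2a+a≡3a = solve-∀
  2k≤3r : 2 * k ≤ 3 * r
  2k≤3r = +-cancelʳ-≤ (3 * e) (2 * k) (3 * r) (begin
    2 * k + 3 * e ≤⟨ +-monoʳ-≤ (2 * k) 3e≤k ⟩
    2 * k + k     ≡⟨ 2a+a≡3a k ⟩
    3 * k         ≡⟨ cong (3 *_) e+r≡k ⟨
    3 * (e + r)   ≡⟨ *-distribˡ-+ 3 e r ⟩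
    3 * e + 3 * r ≡⟨ +-comm (3 * e) (3 * r) ⟩
    3 * r + 3 * e ∎)
  swap₁ : ∀ a b → a * (2 * b) ≡ (2 * a) * b
  swap₁ = solve-∀
  swap₂ : ∀ a b → (3 * a) * b ≡ 3 * (b * a)
  swap₂ = solve-∀
  swap₃ : ∀ b c → 3 * (b * c) ≡ b * (3 * c)
  swap₃ = solve-∀

module _ (f : ℕ → ℕ) (3f≤2f∘suc : ∀ k → 3 * f (2 + k) ≤ 2 * f (3 + k)) (1≤f∘suc : ∀ k → 1 ≤ f (suc k)) where

  pow≤C*f : ∀ e t → (2 + 3 * e + t) ^ e ≤ (2 + 3 * e) ^ e * f (2 + 3 * e + t)
  pow≤C*f e zero = begin
    (K + 0) ^ e     ≡⟨ cong (_^ e) (+-identityʳ K) ⟩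
    K ^ e           ≡⟨ *-identityʳ (K ^ e) ⟨
    K ^ e * 1       ≤⟨ *-monoʳ-≤ (K ^ e) (1≤f∘suc (suc (3 * e + 0))) ⟩
    K ^ e * f (K + 0) ∎
    where
    open ≤-Reasoning
    K = 2 + 3 * e
  pow≤C*f e (suc t) = subst (λ z → z ^ e ≤ K ^ e * f z) (sym (+-suc K t)) (*-cancelˡ-≤ 2 (begin
    2 * suc k ^ e             ≤⟨ 2*[1+k]^e≤3*k^e e k (≤-trans (m≤n+m (3 * e) 2) (m≤m+n K t)) ⟩
    3 * k ^ e                 ≤⟨ *-monoʳ-≤ 3 (pow≤C*f e t) ⟩
    3 * (K ^ e * f k)         ≡⟨ swap (K ^ e) (f k) ⟩
    K ^ e * (3 * f k)         ≤⟨ *-monoʳ-≤ (K ^ e) (3f≤2f∘suc (3 * e + t)) ⟩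
    K ^ e * (2 * f (suc k))   ≡⟨ swap′ (K ^ e) (f (suc k)) ⟩
    2 * (K ^ e * f (suc k))   ∎))
    where
    open ≤-Reasoning
    K = 2 + 3 * e
    k = K + t
    swap : ∀ a b → 3 * (a * b) ≡ a * (3 * b)
    swap = solve-∀
    swap′ : ∀ a b → a * (2 * b) ≡ 2 * (a * b)
    swap′ = solve-∀

  pow≤f-eventually : ∀ e → ∃[ K ] (∀ k → K ≤ k → k ^ e ≤ f k)
  pow≤f-eventually e = K + suc κ , k^e≤fk
    where
    K = 2 + 3 * suc e
    κ = K ^ suc e
    -- the constant of pow≤C*f is absorbed by one extra power of k
    k^e≤fk : ∀ k → K + suc κ ≤ k → k ^ e ≤ f k
    k^e≤fk k K+κ≤k with m≤n⇒∃[o]m+o≡n (≤-trans (m≤m+n K (suc κ)) K+κ≤k)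
    ... | t , refl = *-cancelˡ-≤ (K + t) (begin
      (K + t) * (K + t) ^ e   ≤⟨ pow≤C*f (suc e) t ⟩
      κ * f (K + t)           ≤⟨ *-monoˡ-≤ (f (K + t)) (≤-trans (≤-trans (n≤1+n κ) (m≤n+m (suc κ) K)) K+κ≤k) ⟩
      (K + t) * f (K + t)     ∎)
      where open ≤-Reasoning

pow≤fib-eventually : ∀ e → ∃[ K ] (∀ k → K ≤ k → k ^ e ≤ fib k)
pow≤fib-eventually = pow≤f-eventually fib 3*fib[2+n]≤2*fib[3+n] 1≤fib[1+n]

-- Binomial coefficients and facet counts

nCk≤fib[1+n+k] : ∀ n k → n C k ≤ fib (suc (n + k))
nCk≤fib[1+n+k] zero    zero    = ≤-refl
nCk≤fib[1+n+k] zero    (suc k) = z≤n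
nCk≤fib[1+n+k] (suc n) zero    = 1≤fib[1+n] (suc n + 0)
nCk≤fib[1+n+k] (suc n) (suc k) = begin
  suc n C suc k                              ≡⟨ nCk+nC[k+1]≡[n+1]C[k+1] n k ⟨
  n C k + n C suc k                          ≤⟨ +-mono-≤ (nCk≤fib[1+n+k] n k) (nCk≤fib[1+n+k] n (suc k)) ⟩
  fib (suc (n + k)) + fib (suc (n + suc k))  ≡⟨ cong (λ t → fib (suc (n + k)) + fib (suc t)) (+-suc n k) ⟩
  fib (1 + (n + k)) + fib (2 + (n + k))      ≡⟨ +-comm (fib (1 + (n + k))) (fib (2 + (n + k))) ⟩
  fib (3 + (n + k))                          ≡⟨ cong (λ t → fib (2 + t)) (+-suc n k) ⟨
  fib (suc (suc n + suc k))                  ∎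
  where open ≤-Reasoning

nCk≤1 : ∀ {n k} → n ≤ k → n C k ≤ 1
nCk≤1 {n} n≤k with m≤n⇒m<n∨m≡n n≤k
... | inj₁ n<k  = ≤-trans (≤-reflexive (k>n⇒nCk≡0 n<k)) z≤n
... | inj₂ refl = ≤-reflexive (nCn≡1 n)

nCk≤fib[1+m] : ∀ {m n} k → n ≤ m ∸ k → n C k ≤ fib (suc m)
nCk≤fib[1+m] {m} {n} k n≤m∸k with k ≤? m
... | yes k≤m = ≤-trans (nCk≤fib[1+n+k] n k) (fib-mono (s≤s n+k≤m))
  where
  n+k≤m : n + k ≤ m
  n+k≤m = ≤-trans (+-monoˡ-≤ k n≤m∸k) (≤-reflexive (m∸n+n≡m k≤m))
... | no k≰m with n≤0⇒n≡0 (≤-trans n≤m∸k (≤-reflexive (m≤n⇒m∸n≡0 (<⇒≤ (≰⇒> k≰m)))))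
...   | refl = ≤-trans (nCk≤1 {0} {k} z≤n) (1≤fib[1+n] m)

-- diagonalSum n k = Σ_{i ≤ n} i C (n + k ∸ i), a shallow diagonal of Pascal's triangle
diagonalSum : ℕ → ℕ → ℕ
diagonalSum zero    k = 0 C k
diagonalSum (suc n) k = suc n C k + diagonalSum n (suc k)

diagonalSum-pascal : ∀ n k → diagonalSum (suc n) (suc k) ≡ diagonalSum n (suc k) + diagonalSum n k
diagonalSum-pascal zero    zero    = refl
diagonalSum-pascal zero    (suc k) = refl
diagonalSum-pascal (suc n) k
  rewrite sym (nCk+nC[k+1]≡[n+1]C[k+1] (suc n) k) | diagonalSum-pascal n (suc k) =
  regroup (suc n C k) (suc n C suc k) (diagonalSum n (suc (suc k))) (diagonalSum n (suc k))
  where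
  regroup : ∀ a b c d → (a + b) + (c + d) ≡ (b + c) + (a + d)
  regroup = solve-∀

diagonalSum≡fib : ∀ n → diagonalSum n 0 ≡ fib (suc n)
diagonalSum≡fib zero          = refl
diagonalSum≡fib (suc zero)    = refl
diagonalSum≡fib (suc (suc n)) = begin
  1 + diagonalSum (suc n) 1               ≡⟨ cong (1 +_) (diagonalSum-pascal n 0) ⟩
  1 + (diagonalSum n 1 + diagonalSum n 0) ≡⟨ +-assoc 1 (diagonalSum n 1) (diagonalSum n 0) ⟨
  diagonalSum (suc n) 0 + diagonalSum n 0 ≡⟨ cong₂ _+_ (diagonalSum≡fib (suc n)) (diagonalSum≡fib n) ⟩
  fib (2 + n) + fib (1 + n)               ∎
  where open ≡-Reasoning

diagonalSum≤ : ∀ {B s} → (∀ i j → i + j ≡ s → i C j ≤ B) → ∀ n k → n + k ≡ s → diagonalSum n k ≤ suc n * B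
diagonalSum≤ {B} bound zero    k k≡s = ≤-trans (bound 0 k k≡s) (≤-reflexive (sym (+-identityʳ B)))
diagonalSum≤ {B} bound (suc n) k n+k≡s =
  +-mono-≤ (bound (suc n) k n+k≡s) (diagonalSum≤ bound n (suc k) (trans (+-suc n k) n+k≡s))

halfParity-double : ∀ j → halfParity (j + j) ≡ (j , false)
halfParity-1+double : ∀ j → halfParity (suc (j + j)) ≡ (j , true)
halfParity-double zero = refl
halfParity-double (suc j) rewrite +-suc j j | halfParity-1+double j = refl
halfParity-1+double j rewrite halfParity-double j = refl

cyclicFacets-odd : ∀ k j → cyclicFacets k (suc (j + j)) ≡ 2 * ((k ∸ j ∸ 1) C j)
cyclicFacets-odd k j rewrite halfParity-1+double j = refl

evenFacets≤ : ∀ k n → evenFacets k n ≤ k * fib (suc k)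
evenFacets≤ k n with k ∸ n in k∸n≡
... | zero  = z≤n
... | suc m = ≤-trans (m/n≤m (k * (suc m C n)) (suc m))
                      (*-monoʳ-≤ k (nCk≤fib[1+m] n (≤-reflexive (sym k∸n≡))))

cyclicFacets≤ : ∀ k d → cyclicFacets k d ≤ (2 + k) * fib (suc k)
cyclicFacets≤ k d with halfParity d
... | n , false = ≤-trans (evenFacets≤ k n) (*-monoˡ-≤ (fib (suc k)) (m≤n+m k 2))
... | n , true  = ≤-trans (*-monoʳ-≤ 2 (nCk≤fib[1+m] n (m∸n≤m (k ∸ n) 1)))
                          (*-monoˡ-≤ (fib (suc k)) (m≤m+n 2 k))

maxFacets≤ : ∀ k → maxFacets k ≤ (2 + k) * fib (suc k)
maxFacets≤ k = foldr-preservesᵇ {P = _≤ (2 + k) * fib (suc k)} ⊔-lub z≤n (map⁺ (universal facet≤ (upTo (k ∸ 2))))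
  where
  facet≤ : ∀ i → cyclicFacets k (i + 2) ≤ (2 + k) * fib (suc k)
  facet≤ i = cyclicFacets≤ k (i + 2)

≤maxFacets : ∀ {k d} → 2 ≤ d → d < k → cyclicFacets k d ≤ maxFacets k
≤maxFacets {k} 2≤d d<k with m≤n⇒∃[o]m+o≡n 2≤d
... | o , refl = foldr-preservesᵒ ≤-⊔ 0 _ (inj₂ (any-map⁺ (lose (∈-upTo⁺ o<k∸2) (≤-reflexive (cong (cyclicFacets k) (+-comm 2 o))))))
  where
  ≤-⊔ : ∀ x y → (cyclicFacets k (2 + o) ≤ x) ⊎ (cyclicFacets k (2 + o) ≤ y) → cyclicFacets k (2 + o) ≤ x ⊔ y
  ≤-⊔ x y = [ m≤n⇒m≤n⊔o y , m≤n⇒m≤o⊔n x ]′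
  o<k∸2 : o < k ∸ 2
  o<k∸2 = ∸-monoˡ-≤ 2 d<k

-- For 1 ≤ k < n the binomial n C k is half the number of facets of C(1 + n + k, 1 + 2k).
nCk≤1+maxFacets : ∀ n k → n C k ≤ 1 + maxFacets (suc (n + k))
nCk≤1+maxFacets n zero    = s≤s z≤n
nCk≤1+maxFacets n (suc k) with n ≤? suc k
... | yes n≤1+k = ≤-trans (nCk≤1 n≤1+k) (s≤s z≤n)
... | no  n≰1+k = m≤n⇒m≤1+n (begin
  n C suc k                                  ≤⟨ m≤m+n (n C suc k) (n C suc k + 0) ⟩
  2 * (n C suc k)                            ≡⟨ cong (λ t → 2 * (t C suc k)) K∸[1+k]∸1≡n ⟨
  2 * ((K ∸ suc k ∸ 1) C suc k)              ≡⟨ cyclicFacets-odd K (suc k) ⟨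
  cyclicFacets K (suc (suc k + suc k))       ≤⟨ ≤maxFacets (s≤s (s≤s z≤n)) (s≤s (+-monoˡ-< (suc k) (≰⇒> n≰1+k))) ⟩
  maxFacets K                                ∎)
  where
  open ≤-Reasoning
  K = suc (n + suc k)
  K∸[1+k]∸1≡n : K ∸ suc k ∸ 1 ≡ n
  K∸[1+k]∸1≡n = cong (_∸ 1) (m+n∸n≡m (suc n) (suc k))

fib≤[1+m]*[1+maxFacets] : ∀ m → fib (suc m) ≤ suc m * (1 + maxFacets (suc m))
fib≤[1+m]*[1+maxFacets] m = subst (_≤ suc m * (1 + maxFacets (suc m))) (diagonalSum≡fib m)
  (diagonalSum≤ bound m 0 (+-identityʳ m))
  where
  bound : ∀ i j → i + j ≡ m → i C j ≤ 1 + maxFacets (suc m)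
  bound i j refl = nCk≤1+maxFacets i j

n≤maxFacets[3+n] : ∀ n → n ≤ maxFacets (3 + n)
n≤maxFacets[3+n] n = begin
  n                     ≤⟨ m≤n+m n 3 ⟩
  3 + n                 ≡⟨ facets-of-polygon ⟨
  cyclicFacets (3 + n) 2 ≤⟨ ≤maxFacets {3 + n} ≤-refl (s≤s (s≤s (s≤s z≤n))) ⟩
  maxFacets (3 + n)     ∎
  where
  open ≤-Reasoning
  facets-of-polygon : cyclicFacets (3 + n) 2 ≡ 3 + n
  facets-of-polygon = trans (cong (λ c → (3 + n) * c / (2 + n)) (nC1≡n (2 + n))) (m*n/n≡m (3 + n) (2 + n))

least-witness : ∀ {P : ℕ → Set} → Decidable P → ∀ {m} → P m → ∃[ k ] (P k × (∀ j → j < k → ¬ P j))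
least-witness {P} P? {m} Pm = search 0 m (λ _ ()) Pm
  where
  search : ∀ i d → (∀ j → j < i → ¬ P j) → P (i + d) → ∃[ k ] (P k × (∀ j → j < k → ¬ P j))
  search i zero    below Pi+d = i , subst P (+-identityʳ i) Pi+d , below
  search i (suc d) below Pi+d with P? i
  ... | yes Pi = i , Pi , below
  ... | no ¬Pi = search (suc i) d below′ (subst P (+-suc i d) Pi+d)
    where
    below′ : ∀ j → j < suc i → ¬ P j
    below′ j (s≤s j≤i) with m≤n⇒m<n∨m≡n j≤i
    ... | inj₁ j<i  = below j j<i
    ... | inj₂ refl = ¬Pi

T-exists : ∀ n → ∃[ k ] IsT n k
T-exists n = least-witness {λ k → n ≤ maxFacets k} (λ k → n ≤? maxFacets k) {3 + n} (n≤maxFacets[3+n] n)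

IsT⇒< : ∀ {n k} K → IsT n k → (2 + K) * fib (suc K) < n → K < k
IsT⇒< {n} {k} K (n≤maxFacets[k] , _) bound = ≰⇒> λ k≤K → <⇒≱ bound (begin
  n                         ≤⟨ n≤maxFacets[k] ⟩
  maxFacets k               ≤⟨ maxFacets≤ k ⟩
  (2 + k) * fib (suc k)     ≤⟨ *-mono-≤ (+-monoʳ-≤ 2 k≤K) (fib-mono (s≤s k≤K)) ⟩
  (2 + K) * fib (suc K)     ∎)
  where open ≤-Reasoning

IsT⇒fib≤*n : ∀ {n m} → IsT n (suc m) → fib m ≤ m * n
IsT⇒fib≤*n {m = zero}  _             = z≤n
IsT⇒fib≤*n {m = suc j} (_ , minimal) =
  ≤-trans (fib≤[1+m]*[1+maxFacets] j) (*-monoʳ-≤ (suc j) (≰⇒> (minimal (suc j) ≤-refl)))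

n^c≤fib[1+[1+c]*k] : ∀ c {n k} → n ≤ maxFacets k → (2 + k) ^ c ≤ fib (suc k) → n ^ c ≤ fib (suc (suc c * k))
n^c≤fib[1+[1+c]*k] c {n} {k} n≤maxFacets[k] [2+k]^c≤fib = begin
  n ^ c                             ≤⟨ ^-monoˡ-≤ c (≤-trans n≤maxFacets[k] (maxFacets≤ k)) ⟩
  ((2 + k) * fib (suc k)) ^ c       ≡⟨ ^-distribʳ-* (2 + k) (fib (suc k)) c ⟩
  (2 + k) ^ c * fib (suc k) ^ c     ≤⟨ *-mono-≤ [2+k]^c≤fib (fib[1+n]^c≤fib[1+c*n] c k) ⟩
  fib (suc k) * fib (suc (c * k))   ≤⟨ fib[1+m]*fib[1+n]≤fib[1+m+n] k (c * k) ⟩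
  fib (suc (suc c * k))             ∎
  where open ≤-Reasoning

-- For m = T(n) − 1 we have φ^m ≲ m n; the factor m^b is absorbed by m^(2 + b) ≤ φ^m.
fib[2+b*[1+m]]≤n^[1+b] : ∀ b m n .{{_ : NonZero m}} → 2 ^ b * fib (b + 2 + b) ≤ m →
                         m ^ (2 + b) ≤ fib m → fib m ≤ m * n → fib (2 + b * suc m) ≤ n ^ suc b
fib[2+b*[1+m]]≤n^[1+b] b m@(suc j) n κ≤m m^[2+b]≤fib fib≤mn = begin
  fib (2 + b * suc m)                  ≡⟨ cong fib (reindex b m) ⟩
  fib (b * m + (b + 2))                ≤⟨ fib[b*n+j]≤fib[1+n]^b*fib[j+b] b m (b + 2) ⟩
  fib (suc m) ^ b * F                  ≤⟨ *-monoˡ-≤ F (^-monoˡ-≤ b fib[1+m]≤2mn) ⟩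
  (2 * (m * n)) ^ b * F                ≡⟨ cong (_* F) (trans (^-distribʳ-* 2 (m * n) b) (cong (2 ^ b *_) (^-distribʳ-* m n b))) ⟩
  2 ^ b * (m ^ b * n ^ b) * F          ≡⟨ regroup (2 ^ b) (m ^ b) (n ^ b) F ⟩
  κ * m ^ b * n ^ b                    ≤⟨ *-monoˡ-≤ (n ^ b) κm^b≤n ⟩
  n * n ^ b                            ∎
  where
  open ≤-Reasoning
  F = fib (b + 2 + b)
  κ = 2 ^ b * F
  reindex : ∀ b m → 2 + b * suc m ≡ b * m + (b + 2)
  reindex = solve-∀
  regroup : ∀ p q r f → p * (q * r) * f ≡ p * f * q * r
  regroup = solve-∀
  swap : ∀ x y z → x * (y * z) ≡ y * (x * z)
  swap = solve-∀
  fib[1+m]≤2mn : fib (suc m) ≤ 2 * (m * n)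
  fib[1+m]≤2mn = ≤-trans (fib[2+n]≤2*fib[1+n] j) (*-monoʳ-≤ 2 fib≤mn)
  κm^b≤n : κ * m ^ b ≤ n
  κm^b≤n = *-cancelˡ-≤ m (begin
    m * (κ * m ^ b)   ≡⟨ swap m κ (m ^ b) ⟩
    κ * (m * m ^ b)   ≤⟨ *-monoˡ-≤ (m * m ^ b) κ≤m ⟩
    m ^ (2 + b)       ≤⟨ m^[2+b]≤fib ⟩
    fib m             ≤⟨ fib≤mn ⟩
    m * n             ∎)

mainTheorem4 : (a b : ℕ) → 1 ≤ a → 1 ≤ b →
    ∃[ N ] ((n : ℕ) → N ≤ n →
      ∃[ k ] (IsT n k × ≤PhiPow (n ^ (b ∸ a)) (b * k) × PhiPow≤ (b * k) (n ^ (b + a))))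
mainTheorem4 a b 1≤a 1≤b with pow≤fib-eventually (2 * (b ∸ a)) | pow≤fib-eventually (2 + b)
... | K₁ , poly₁ | K₂ , poly₂ = suc ((3 + K) * fib (2 + K)) , λ n N≤n →
  let k , isT = T-exists n in k , isT , φ-bounds isT (IsT⇒< (suc K) isT N≤n) N≤n
  where
  K = K₁ ⊔ K₂ ⊔ 2 ^ b * fib (b + 2 + b)
  φ-bounds : ∀ {n k} → IsT n k → suc K < k → suc ((3 + K) * fib (2 + K)) ≤ n →
             ≤PhiPow (n ^ (b ∸ a)) (b * k) × PhiPow≤ (b * k) (n ^ (b + a))
  φ-bounds {n} {suc (suc j)} isT (s≤s (s≤s K≤j)) N≤n =
    N≤fib[1+m]⇒N≤φ^m (n ^ (b ∸ a)) (b * (2 + j)) lower , fib[2+m]≤N⇒φ^m≤N (b * (2 + j)) (n ^ (b + a)) upper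
    where
    K₁≤j : K₁ ≤ j
    K₁≤j = ≤-trans (≤-trans (m≤m⊔n K₁ K₂) (m≤m⊔n _ _)) K≤j
    K₂≤j : K₂ ≤ j
    K₂≤j = ≤-trans (≤-trans (m≤n⊔m K₁ K₂) (m≤m⊔n _ _)) K≤j
    κ≤j : 2 ^ b * fib (b + 2 + b) ≤ j
    κ≤j = ≤-trans (m≤n⊔m (K₁ ⊔ K₂) _) K≤j
    lower : n ^ (b ∸ a) ≤ fib (suc (b * (2 + j)))
    lower = ≤-trans (n^c≤fib[1+[1+c]*k] (b ∸ a) {n} {2 + j} (proj₁ isT)
                      (≤-trans ([3+k]^c≤[2+k]^[2*c] (b ∸ a) (suc j)) (poly₁ (3 + j) (m≤n⇒m≤o+n 3 K₁≤j))))
                    (fib-mono (s≤s (*-monoˡ-≤ (2 + j) (suc[m∸n]≤m 1≤b 1≤a))))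
    upper : fib (2 + b * (2 + j)) ≤ n ^ (b + a)
    upper = ≤-trans (fib[2+b*[1+m]]≤n^[1+b] b (suc j) n (m≤n⇒m≤1+n κ≤j) (poly₂ (suc j) (m≤n⇒m≤1+n K₂≤j))
                      (IsT⇒fib≤*n {n} {suc j} isT))
                    (^-monoʳ-≤ n {{>-nonZero (≤-trans (s≤s z≤n) N≤n)}} (subst (_≤ b + a) (+-comm b 1) (+-monoʳ-≤ b 1≤a)))
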